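{- Let $\mathcal{L}=(L_1,L_2,P,\&_1,\swarrow^1,\nwarrow_1,\dots,\&_n,\swarrow^n,\nwarrow_n)$ be a multi-adjoint object-oriented frame. Then the following data define a non-trivial quantaloid $\mathcal{Q}_O^{\mathcal{L}}$: (i) objects: $-1,0,1,\dots,n$; (ii) hom-sets: $\mathcal{Q}_O^{\mathcal{L}}(-1,0)=L_1$, $\mathcal{Q}_O^{\mathcal{L}}(0,i)=P$, $\mathcal{Q}_O^{\mathcal{L}}(-1,i)=L_2$ for $i=1,\dots,n$; $\mathcal{Q}_O^{\mathcal{L}}(i,i)=\{\bot_{i,i}<\mathrm{id}_i\}$ for $i=-1,0,1,\dots,n$; and $\mathcal{Q}_O^{\mathcal{L}}(i,j)=\{\bot_{i,j}\}$ (one element) whenever $-1\le j<i\le n$ or $0<i<j\le n$; (iii) composition: $v\circ u=u\,\&_i\,v$ for $u\in\mathcal{Q}_O^{\mathcal{L}}(-1,0)=L_1$, $v\in\mathcal{Q}_O^{\mathcal{L}}(0,i)=P$ ($i=1,\dots,n$); composition with identities is given by the identity law, and all other composites are the bottom element of the relevant hom-set. Moreover, the left and right implications satisfy $w/u=w\nwarrow_i u$ and $v\backslash w=w\swarrow^i v$ for all $u\in L_1$, $v\in P$, $w\in\mathcal{Q}_O^{\mathcal{L}}(-1,i)=L_2$ ($i=1,\dots,n$), all other implications being trivial.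
   Context: A multi-adjoint object-oriented frame $\mathcal{L}$ consists of complete lattices $L_1,L_2,P$ and, for $i=1,\dots,n$, maps $\&_i:L_1\times P\to L_2$, $\swarrow^i:L_2\times P\to L_1$, $\nwarrow_i:L_2\times L_1\to P$ such that $x\,\&_i\,z\le y\iff x\le y\swarrow^i z\iff z\le y\nwarrow_i x$ for all $x\in L_1$, $z\in P$, $y\in L_2$. A quantaloid is a category whose hom-sets are complete lattices and whose composition preserves arbitrary joins in each variable; for $u\in\mathcal{Q}(p,q)$, $v\in\mathcal{Q}(q,r)$, $w\in\mathcal{Q}(p,r)$ the left and right implications $w/u\in\mathcal{Q}(q,r)$, $v\backslash w\in\mathcal{Q}(p,q)$ are defined by $v\circ u\le w\iff v\le w/u\iff u\le v\backslash w$. It is non-trivial if $\bot_{q,q}<\mathrm{id}_q$ for every object $q$. -}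

module Defs where

open import Level using (Level; _⊔_; suc)
open import Data.Nat using (ℕ)
open import Data.Fin using (Fin; _≟_)
open import Data.Product using (Σ; _×_; _,_)
open import Data.Unit.Polymorphic using (⊤; tt)
open import Data.Empty using () renaming (⊥-elim to ⊥₀-elim)
open import Data.Empty.Polymorphic using (⊥)
open import Relation.Nullary using (Dec; yes; no; ¬_)
open import Relation.Binary using (Rel; IsPartialOrder; IsPreorder; IsEquivalence)
open import Relation.Binary.PropositionalEquality using (_≡_; refl)
open import Function.Bundles using (_⇔_)
open import Axiom.ExcludedMiddle using (ExcludedMiddle)

record CompleteLattice (c ℓ ι : Level) : Set (suc (c ⊔ ℓ ⊔ ι)) where
  field
    Carrier        : Set c
    _≈_            : Rel Carrier ℓ
    _≤_            : Rel Carrier ℓ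
    isPartialOrder : IsPartialOrder _≈_ _≤_
    ⋁              : {I : Set ι} → (I → Carrier) → Carrier
    ⋁-upper        : ∀ {I : Set ι} (f : I → Carrier) (i : I) → f i ≤ ⋁ f
    ⋁-least        : ∀ {I : Set ι} (f : I → Carrier) (x : Carrier) →
                     (∀ i → f i ≤ x) → ⋁ f ≤ x

  ⊥L : Carrier
  ⊥L = ⋁ {I = ⊥} (λ ())

  _<_ : Rel Carrier ℓ
  x < y = (x ≤ y) × ¬ (x ≈ y)

∣_∣ : ∀ {c ℓ ι} → CompleteLattice c ℓ ι → Set c
∣ L ∣ = CompleteLattice.Carrier L

_≈[_]_ : ∀ {c ℓ ι} {L : CompleteLattice c ℓ ι} → ∣ L ∣ → (L' : CompleteLattice c ℓ ι) → ∣ L ∣ → Set ℓ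
_≈[_]_ {L = L} x _ y = CompleteLattice._≈_ L x y

module _ {c ℓ ι} (L : CompleteLattice c ℓ ι) where
  Le : ∣ L ∣ → ∣ L ∣ → Set ℓ
  Le = CompleteLattice._≤_ L
  Eq : ∣ L ∣ → ∣ L ∣ → Set ℓ
  Eq = CompleteLattice._≈_ L
  Lt : ∣ L ∣ → ∣ L ∣ → Set ℓ
  Lt = CompleteLattice._<_ L
  Join : {I : Set ι} → (I → ∣ L ∣) → ∣ L ∣
  Join = CompleteLattice.⋁ L
  Bot : ∣ L ∣
  Bot = CompleteLattice.⊥L L

-- Multi-adjoint object-oriented frames (indices i = 1..n encoded as Fin n)

record MultiAdjointFrame (c ℓ ι : Level) (n : ℕ) : Set (suc (c ⊔ ℓ ⊔ ι)) where
  field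
    L₁ L₂ P : CompleteLattice c ℓ ι
    _&[_]_  : ∣ L₁ ∣ → Fin n → ∣ P ∣ → ∣ L₂ ∣
    _↙[_]_  : ∣ L₂ ∣ → Fin n → ∣ P ∣ → ∣ L₁ ∣
    _↖[_]_  : ∣ L₂ ∣ → Fin n → ∣ L₁ ∣ → ∣ P ∣
    adj₁ : ∀ i (x : ∣ L₁ ∣) (z : ∣ P ∣) (y : ∣ L₂ ∣) →
           Le L₂ (x &[ i ] z) y ⇔ Le L₁ x (y ↙[ i ] z)
    adj₂ : ∀ i (x : ∣ L₁ ∣) (z : ∣ P ∣) (y : ∣ L₂ ∣) →
           Le L₁ x (y ↙[ i ] z) ⇔ Le P z (y ↖[ i ] x)

record IsQuantaloid {o c ℓ ι} {Ob : Set o} (Hom : Ob → Ob → CompleteLattice c ℓ ι)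
    (comp : ∀ x y z → ∣ Hom y z ∣ → ∣ Hom x y ∣ → ∣ Hom x z ∣)
    (idQ : ∀ x → ∣ Hom x x ∣) : Set (o ⊔ c ⊔ ℓ ⊔ suc ι) where
  field
    comp-cong  : ∀ x y z {v v' : ∣ Hom y z ∣} {u u' : ∣ Hom x y ∣} →
                 Eq (Hom y z) v v' → Eq (Hom x y) u u' →
                 Eq (Hom x z) (comp x y z v u) (comp x y z v' u')
    assoc      : ∀ w x y z (h : ∣ Hom y z ∣) (g : ∣ Hom x y ∣) (f : ∣ Hom w x ∣) →
                 Eq (Hom w z) (comp w x z (comp x y z h g) f) (comp w y z h (comp w x y g f))
    identityˡ  : ∀ x y (f : ∣ Hom x y ∣) → Eq (Hom x y) (comp x y y (idQ y) f) f
    identityʳ  : ∀ x y (f : ∣ Hom x y ∣) → Eq (Hom x y) (comp x x y f (idQ x)) f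
    comp-⋁ˡ    : ∀ x y z {I : Set ι} (vs : I → ∣ Hom y z ∣) (u : ∣ Hom x y ∣) →
                 Eq (Hom x z) (comp x y z (Join (Hom y z) vs) u)
                              (Join (Hom x z) (λ i → comp x y z (vs i) u))
    comp-⋁ʳ    : ∀ x y z {I : Set ι} (v : ∣ Hom y z ∣) (us : I → ∣ Hom x y ∣) →
                 Eq (Hom x z) (comp x y z v (Join (Hom x y) us))
                              (Join (Hom x z) (λ i → comp x y z v (us i)))

IsNonTrivial : ∀ {o c ℓ ι} {Ob : Set o} (Hom : Ob → Ob → CompleteLattice c ℓ ι)
    (idQ : ∀ x → ∣ Hom x x ∣) → Set (o ⊔ ℓ)
IsNonTrivial Hom idQ = ∀ q → Lt (Hom q q) (Bot (Hom q q)) (idQ q)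

IsLeftImp : ∀ {o c ℓ ι} {Ob : Set o} (Hom : Ob → Ob → CompleteLattice c ℓ ι)
    (comp : ∀ x y z → ∣ Hom y z ∣ → ∣ Hom x y ∣ → ∣ Hom x z ∣)
    (p q r : Ob) (u : ∣ Hom p q ∣) (w : ∣ Hom p r ∣) (res : ∣ Hom q r ∣) → Set (c ⊔ ℓ)
IsLeftImp Hom comp p q r u w res =
  ∀ (v : ∣ Hom q r ∣) → Le (Hom p r) (comp p q r v u) w ⇔ Le (Hom q r) v res

IsRightImp : ∀ {o c ℓ ι} {Ob : Set o} (Hom : Ob → Ob → CompleteLattice c ℓ ι)
    (comp : ∀ x y z → ∣ Hom y z ∣ → ∣ Hom x y ∣ → ∣ Hom x z ∣)
    (p q r : Ob) (v : ∣ Hom q r ∣) (w : ∣ Hom p r ∣) (res : ∣ Hom p q ∣) → Set (c ⊔ ℓ)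
IsRightImp Hom comp p q r v w res =
  ∀ (u : ∣ Hom p q ∣) → Le (Hom p r) (comp p q r v u) w ⇔ Le (Hom p q) u res

OneL : ∀ {c ℓ ι} → CompleteLattice c ℓ ι
OneL {c} {ℓ} {ι} = record
  { Carrier = ⊤
  ; _≈_ = λ _ _ → ⊤
  ; _≤_ = λ _ _ → ⊤
  ; isPartialOrder = record
      { isPreorder = record
          { isEquivalence = record { refl = tt ; sym = λ _ → tt ; trans = λ _ _ → tt }
          ; reflexive = λ _ → tt
          ; trans = λ _ _ → tt }
      ; antisym = λ _ _ → tt }
  ; ⋁ = λ _ → tt
  ; ⋁-upper = λ _ _ → tt
  ; ⋁-least = λ _ _ _ → tt
  }

-- The two-element chain {⊥ < id}.  Its completeness (joins of arbitrary
-- families) is a classical fact; we use excluded middle to decide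
-- whether some member of a family is the top element.

data 𝟚 {c : Level} : Set c where
  bot top : 𝟚

data _≤𝟚_ {c ℓ : Level} : 𝟚 {c} → 𝟚 {c} → Set ℓ where
  b≤b : bot ≤𝟚 bot
  b≤t : bot ≤𝟚 top
  t≤t : top ≤𝟚 top

data _≈𝟚_ {c ℓ : Level} : 𝟚 {c} → 𝟚 {c} → Set ℓ where
  b≈b : bot ≈𝟚 bot
  t≈t : top ≈𝟚 top

module _ {c ℓ ι : Level} (lem : ExcludedMiddle (c ⊔ ι)) where
  private
    bot≤ : (x : 𝟚 {c}) → _≤𝟚_ {c} {ℓ} bot x
    bot≤ bot = b≤b
    bot≤ top = b≤t

    dec→𝟚 : ∀ {a} {A : Set a} → Dec A → 𝟚 {c}
    dec→𝟚 (yes _) = top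
    dec→𝟚 (no _)  = bot

    x≤top : (x : 𝟚 {c}) → _≤𝟚_ {c} {ℓ} x top
    x≤top bot = b≤t
    x≤top top = t≤t

    ub : {I : Set ι} (f : I → 𝟚 {c}) (i : I) (d : Dec (Σ I (λ k → f k ≡ top))) →
         _≤𝟚_ {c} {ℓ} (f i) (dec→𝟚 d)
    ub f i (yes _) = x≤top (f i)
    ub f i (no ¬e) with f i in eq
    ... | bot = bot≤ _
    ... | top = ⊥₀-elim (¬e (i , eq))

    lst : {I : Set ι} (f : I → 𝟚 {c}) (x : 𝟚) → (∀ i → _≤𝟚_ {c} {ℓ} (f i) x) →
          (d : Dec (Σ I (λ k → f k ≡ top))) → _≤𝟚_ {c} {ℓ} (dec→𝟚 d) x
    lst f x h (no _) = bot≤ x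
    lst f x h (yes (i , e)) with h i
    ... | q rewrite e = q

  TwoL : CompleteLattice c ℓ ι
  TwoL = record
    { Carrier = 𝟚 {c}
    ; _≈_ = _≈𝟚_
    ; _≤_ = _≤𝟚_
    ; isPartialOrder = record
        { isPreorder = record
            { isEquivalence = record { refl = rfl ; sym = sm ; trans = tr }
            ; reflexive = rx
            ; trans = tr≤ }
        ; antisym = as }
    ; ⋁ = λ {I} f → dec→𝟚 (lem {Σ I (λ k → f k ≡ top)})
    ; ⋁-upper = λ {I} f i → ub f i lem
    ; ⋁-least = λ {I} f x h → lst f x h lem
    }
    where
      rfl : ∀ {x} → _≈𝟚_ {c} {ℓ} x x
      rfl {bot} = b≈b
      rfl {top} = t≈t
      sm : ∀ {x y} → _≈𝟚_ {c} {ℓ} x y → _≈𝟚_ {c} {ℓ} y x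
      sm b≈b = b≈b
      sm t≈t = t≈t
      tr : ∀ {x y z} → _≈𝟚_ {c} {ℓ} x y → _≈𝟚_ {c} {ℓ} y z → _≈𝟚_ {c} {ℓ} x z
      tr b≈b q = q
      tr t≈t q = q
      rx : ∀ {x y} → _≈𝟚_ {c} {ℓ} x y → _≤𝟚_ {c} {ℓ} x y
      rx b≈b = b≤b
      rx t≈t = t≤t
      tr≤ : ∀ {x y z} → _≤𝟚_ {c} {ℓ} x y → _≤𝟚_ {c} {ℓ} y z → _≤𝟚_ {c} {ℓ} x z
      tr≤ b≤b q = q
      tr≤ b≤t t≤t = b≤t
      tr≤ t≤t q = q
      as : ∀ {x y} → _≤𝟚_ {c} {ℓ} x y → _≤𝟚_ {c} {ℓ} y x → _≈𝟚_ {c} {ℓ} x y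
      as b≤b _ = b≈b
      as t≤t _ = t≈t

-- Objects -1, 0, 1, ..., n :  obj₋₁ = -1,  obj₀ = 0,  obj i = i+1 (i : Fin n)

data Ob (n : ℕ) : Set where
  obj₋₁ obj₀ : Ob n
  obj        : Fin n → Ob n

data Kind : Set where
  one two k₁ kP k₂ : Kind

kindD : ∀ {a} {A : Set a} → Dec A → Kind
kindD (yes _) = two
kindD (no _)  = one

kind : ∀ {n} → Ob n → Ob n → Kind
kind obj₋₁   obj₋₁   = two
kind obj₋₁   obj₀    = k₁
kind obj₋₁   (obj _) = k₂
kind obj₀    obj₋₁   = one
kind obj₀    obj₀    = two
kind obj₀    (obj _) = kP
kind (obj _) obj₋₁   = one
kind (obj _) obj₀    = one
kind (obj i) (obj j) = kindD (i ≟ j)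

sel : ∀ {c a} {A : Set a} → 𝟚 {c} → A → A → A
sel top a _ = a
sel bot _ b = b

module QO {c ℓ ι : Level} {n : ℕ} (lem : ExcludedMiddle (c ⊔ ι))
          (𝓛 : MultiAdjointFrame c ℓ ι n) where
  open MultiAdjointFrame 𝓛

  KL : Kind → CompleteLattice c ℓ ι
  KL one = OneL
  KL two = TwoL {ι = ι} lem
  KL k₁  = L₁
  KL kP  = P
  KL k₂  = L₂

  Hom : Ob n → Ob n → CompleteLattice c ℓ ι
  Hom x y = KL (kind x y)

  H : Ob n → Ob n → Set c
  H x y = ∣ Hom x y ∣

  ⊥H : ∀ x y → H x y
  ⊥H x y = Bot (Hom x y)

  idD : ∀ {a} {A : Set a} (d : Dec A) → ∣ KL (kindD d) ∣
  idD (yes _) = top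
  idD (no _)  = tt

  idQ : ∀ x → H x x
  idQ obj₋₁   = top
  idQ obj₀    = top
  idQ (obj i) = idD (i ≟ i)

  compD : ∀ {a} {A : Set a} {X : Set c} (d : Dec A) → ∣ KL (kindD d) ∣ → X → X → X
  compD (yes _) v u b = sel v u b
  compD (no _)  _ _ b = b

  -- composite Q(j,k) ∘ Q(i,j) → Q(i,k), i,j,k ≥ 1
  comp3 : ∀ {a} {A B C : Set a} (d₁ : Dec A) (d₂ : Dec B) (d₃ : Dec C) →
          ∣ KL (kindD d₂) ∣ → ∣ KL (kindD d₁) ∣ → ∣ KL (kindD d₃) ∣
  comp3 (yes _) (yes _) (yes _) v u = sel u v (Bot (KL two))
  comp3 _ _ d₃ _ _ = Bot (KL (kindD d₃))

  comp : ∀ x y z → H y z → H x y → H x z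
  comp obj₋₁ obj₋₁ z v u = sel u v (⊥H obj₋₁ z)
  comp obj₋₁ obj₀ obj₋₁ v u = ⊥H obj₋₁ obj₋₁
  comp obj₋₁ obj₀ obj₀ v u = sel v u (⊥H obj₋₁ obj₀)
  comp obj₋₁ obj₀ (obj i) v u = u &[ i ] v
  comp obj₋₁ (obj j) obj₋₁ v u = ⊥H obj₋₁ obj₋₁
  comp obj₋₁ (obj j) obj₀ v u = ⊥H obj₋₁ obj₀
  comp obj₋₁ (obj j) (obj k) v u = compD (j ≟ k) v u (⊥H obj₋₁ (obj k))
  comp obj₀ obj₋₁ z v u = ⊥H obj₀ z
  comp obj₀ obj₀ z v u = sel u v (⊥H obj₀ z)
  comp obj₀ (obj j) obj₋₁ v u = ⊥H obj₀ obj₋₁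
  comp obj₀ (obj j) obj₀ v u = ⊥H obj₀ obj₀
  comp obj₀ (obj j) (obj k) v u = compD (j ≟ k) v u (⊥H obj₀ (obj k))
  comp (obj i) obj₋₁ z v u = ⊥H (obj i) z
  comp (obj i) obj₀ z v u = ⊥H (obj i) z
  comp (obj i) (obj j) obj₋₁ v u = ⊥H (obj i) obj₋₁
  comp (obj i) (obj j) obj₀ v u = ⊥H (obj i) obj₀
  comp (obj i) (obj j) (obj k) v u = comp3 (i ≟ j) (j ≟ k) (i ≟ k) v u

module Submission where

-- Besides identities and composites forced to be ⊥, the only composition is u &ᵢ v, and the
-- adjunctions make &ᵢ a left adjoint in each variable, so it preserves all joins (in particular ⊥)
-- on both sides. Composing with an arrow of a two-element hom-set is the action of the chain
-- {⊥ < id}, and on the objects 1, …, n the quantaloid is discrete, i.e. composition is meet in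
-- that chain. Associativity is then a case analysis on the four objects in which every composite
-- through a trivial hom-set is ⊥ on both sides, ⊥ being absorbing since composition preserves the
-- empty join. The implications are the two adjunctions read in the quantaloid.

open import Level using (Level; _⊔_)
open import Axiom.ExcludedMiddle using (ExcludedMiddle)
open import Data.Empty using () renaming (⊥ to ⊥₀; ⊥-elim to ⊥₀-elim)
open import Data.Fin using (Fin; _≟_)
open import Data.Product using (Σ; _×_; _,_)
open import Data.Sum using (_⊎_; inj₁; inj₂)
open import Data.Unit.Polymorphic using (tt)
open import Function.Bundles using (_⇔_; Equivalence)
open import Function.Properties.Equivalence using () renaming (trans to ⇔-trans)
open import Relation.Binary using (IsPartialOrder)
open import Relation.Binary.PropositionalEquality using (_≡_; refl; sym; trans; cong; cong₂; subst; module ≡-Reasoning)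
open import Relation.Nullary using (Dec; yes; no)

open import Defs

module CompleteLatticeProperties {c ℓ ι} (L : CompleteLattice c ℓ ι) where
  open CompleteLattice L public
  open IsPartialOrder isPartialOrder public
    using (reflexive; antisym) renaming (refl to ≤-refl; trans to ≤-trans)
  open IsPartialOrder isPartialOrder using (module Eq)

  ≈-refl : ∀ {x} → x ≈ x
  ≈-refl = Eq.refl

  ≈-sym : ∀ {x y} → x ≈ y → y ≈ x
  ≈-sym = Eq.sym

  ≈-trans : ∀ {x y z} → x ≈ y → y ≈ z → x ≈ z
  ≈-trans = Eq.trans

  ≡⇒≈ : ∀ {x y} → x ≡ y → x ≈ y
  ≡⇒≈ refl = ≈-refl

  ⊥L-least : ∀ x → ⊥L ≤ x
  ⊥L-least x = ⋁-least (λ ()) x (λ ())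

  ⋁-⊥ : ∀ {I : Set ι} (f : I → Carrier) → (∀ i → f i ≈ ⊥L) → ⋁ f ≈ ⊥L
  ⋁-⊥ f f≈⊥ = antisym (⋁-least f ⊥L (λ i → reflexive (f≈⊥ i))) (⊥L-least (⋁ f))

  ⊥L≈⋁⊥L : ∀ {I : Set ι} → ⊥L ≈ ⋁ {I} (λ _ → ⊥L)
  ⊥L≈⋁⊥L = ≈-sym (⋁-⊥ _ (λ _ → ≈-refl))

  both-≈⊥L : ∀ {x y} → x ≈ ⊥L → y ≈ ⊥L → x ≈ y
  both-≈⊥L x≈⊥ y≈⊥ = ≈-trans x≈⊥ (≈-sym y≈⊥)

  ⋁-attained : ∀ {I : Set ι} (f : I → Carrier) {x} (i : I) →
               f i ≈ x → (∀ j → f j ≤ x) → ⋁ f ≈ x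
  ⋁-attained f i fi≈x f≤x =
    antisym (⋁-least f _ f≤x) (≤-trans (reflexive (≈-sym fi≈x)) (⋁-upper f i))

module CL = CompleteLatticeProperties

module LeftAdjoint {c ℓ ι} {A B : CompleteLattice c ℓ ι}
    (f : ∣ A ∣ → ∣ B ∣) (g : ∣ B ∣ → ∣ A ∣)
    (f⊣g : ∀ x y → Le B (f x) y ⇔ Le A x (g y)) where
  private
    module A = CompleteLatticeProperties A
    module B = CompleteLatticeProperties B
  open Equivalence

  mono : ∀ {x x'} → Le A x x' → Le B (f x) (f x')
  mono {x' = x'} x≤x' = from (f⊣g _ _) (A.≤-trans x≤x' (to (f⊣g x' _) B.≤-refl))

  cong-≈ : ∀ {x x'} → Eq A x x' → Eq B (f x) (f x')
  cong-≈ x≈x' = B.antisym (mono (A.reflexive x≈x')) (mono (A.reflexive (A.≈-sym x≈x')))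

  ⋁-preserving : ∀ {I : Set ι} (xs : I → ∣ A ∣) →
                 Eq B (f (Join A xs)) (Join B (λ k → f (xs k)))
  ⋁-preserving xs = B.antisym
    (from (f⊣g _ _) (A.⋁-least xs _ (λ k → to (f⊣g _ _) (B.⋁-upper (λ k → f (xs k)) k))))
    (B.⋁-least _ _ (λ k → mono (A.⋁-upper xs k)))

  ⊥-preserving : Eq B (f (Bot A)) (Bot B)
  ⊥-preserving = B.≈-trans (⋁-preserving (λ ())) (B.⋁-⊥ _ (λ ()))

module FrameProperties {c ℓ ι n} (𝓛 : MultiAdjointFrame c ℓ ι n) where
  open MultiAdjointFrame 𝓛

  &⊣↖ : ∀ i x z y → Le L₂ (x &[ i ] z) y ⇔ Le P z (y ↖[ i ] x)
  &⊣↖ i x z y = ⇔-trans (adj₁ i x z y) (adj₂ i x z y)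

  module &ˡ i z = LeftAdjoint {A = L₁} {B = L₂} (_&[ i ] z) (_↙[ i ] z) (λ x y → adj₁ i x z y)
  module &ʳ i x = LeftAdjoint {A = P} {B = L₂} (x &[ i ]_) (_↖[ i ] x) (λ z y → &⊣↖ i x z y)

  &-cong : ∀ i {x x' z z'} → Eq L₁ x x' → Eq P z z' → Eq L₂ (x &[ i ] z) (x' &[ i ] z')
  &-cong i {x' = x'} {z = z} x≈x' z≈z' =
    CL.≈-trans L₂ (&ˡ.cong-≈ i z x≈x') (&ʳ.cong-≈ i x' z≈z')

module TwoLProperties {c ℓ ι : Level} (lem : ExcludedMiddle (c ⊔ ι)) where
  𝟚L : CompleteLattice c ℓ ι
  𝟚L = TwoL {ι = ι} lem

  private
    ≤bot⇒≡bot : ∀ {x : 𝟚 {c}} → _≤𝟚_ {c} {ℓ} x bot → x ≡ bot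
    ≤bot⇒≡bot b≤b = refl

  -- ⊥ of the chain is a join computed by excluded middle, so it is bot only propositionally.
  ⊥𝟚L≡bot : Bot 𝟚L ≡ bot
  ⊥𝟚L≡bot = ≤bot⇒≡bot (CL.⊥L-least 𝟚L bot)

  bot<top : Lt 𝟚L (Bot 𝟚L) top
  bot<top = CL.⊥L-least 𝟚L top , λ ⊥≈top → bot≉top (subst (λ t → _≈𝟚_ {c} {ℓ} t top) ⊥𝟚L≡bot ⊥≈top)
    where
      bot≉top : _≈𝟚_ {c} {ℓ} bot top → ⊥₀
      bot≉top ()

  ⋁-cases : ∀ {I : Set ι} (us : I → 𝟚 {c}) →
            (Σ I (λ i → us i ≡ top) × Join 𝟚L us ≡ top) ⊎ ((∀ i → us i ≡ bot) × Join 𝟚L us ≡ bot)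
  ⋁-cases {I} us with lem {Σ I (λ i → us i ≡ top)}
  ... | yes ∃top = inj₁ (∃top , refl)
  ... | no ∄top = inj₂ (all-bot , refl)
    where
      all-bot : ∀ i → us i ≡ bot
      all-bot i with us i in eq
      ... | bot = refl
      ... | top = ⊥₀-elim (∄top (i , eq))

  _∧_ : 𝟚 {c} → 𝟚 {c} → 𝟚 {c}
  u ∧ v = sel u v bot

  x∧bot≡bot : ∀ u → u ∧ bot ≡ bot
  x∧bot≡bot top = refl
  x∧bot≡bot bot = refl

  x∧top≡x : ∀ u → u ∧ top ≡ u
  x∧top≡x top = refl
  x∧top≡x bot = refl

  ∧-assoc : ∀ u v w → (u ∧ v) ∧ w ≡ u ∧ (v ∧ w)
  ∧-assoc top v w = refl
  ∧-assoc bot v w = refl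

  ≈𝟚⇒≡ : ∀ {u v : 𝟚 {c}} → _≈𝟚_ {c} {ℓ} u v → u ≡ v
  ≈𝟚⇒≡ b≈b = refl
  ≈𝟚⇒≡ t≈t = refl

  -- Composing with an arrow of a two-element hom-set {⊥ < id} is this action of the chain.
  module Scaling (L : CompleteLattice c ℓ ι) where
    private
      module L = CompleteLatticeProperties L

    _·_ : 𝟚 {c} → ∣ L ∣ → ∣ L ∣
    u · x = sel u x (Bot L)

    ·-cong : ∀ {u u' x x'} → _≈𝟚_ {c} {ℓ} u u' → Eq L x x' → Eq L (u · x) (u' · x')
    ·-cong b≈b x≈x' = L.≈-refl
    ·-cong t≈t x≈x' = x≈x'

    ⊥𝟚L·x≡⊥ : ∀ x → Bot 𝟚L · x ≡ Bot L
    ⊥𝟚L·x≡⊥ x = cong (λ t → t · x) ⊥𝟚L≡bot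

    x·⊥≡⊥ : ∀ u → u · Bot L ≡ Bot L
    x·⊥≡⊥ top = refl
    x·⊥≡⊥ bot = refl

    ∧-· : ∀ u v x → (u ∧ v) · x ≡ v · (u · x)
    ∧-· top top x = refl
    ∧-· top bot x = refl
    ∧-· bot v x = sym (x·⊥≡⊥ v)

    ·-⋁ʳ : ∀ {I : Set ι} u (xs : I → ∣ L ∣) → Eq L (u · Join L xs) (Join L (λ k → u · xs k))
    ·-⋁ʳ top xs = L.≈-refl
    ·-⋁ʳ bot xs = L.⊥L≈⋁⊥L

    ·-⋁ˡ : ∀ {I : Set ι} (us : I → 𝟚 {c}) x → Eq L (Join 𝟚L us · x) (Join L (λ k → us k · x))
    ·-⋁ˡ us x with ⋁-cases us
    ... | inj₁ ((i , ui≡top) , ⋁≡top) rewrite ⋁≡top =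
      L.≈-sym (L.⋁-attained _ i (L.≡⇒≈ (cong (_· x) ui≡top)) uk·x≤x)
      where
        uk·x≤x : ∀ k → Le L (us k · x) x
        uk·x≤x k with us k
        ... | top = L.≤-refl
        ... | bot = L.⊥L-least x
    ... | inj₂ (all-bot , ⋁≡bot) rewrite ⋁≡bot =
      L.≈-sym (L.⋁-⊥ _ (λ k → L.≡⇒≈ (cong (_· x) (all-bot k))))

  x·top≈x : ∀ u → Eq 𝟚L (Scaling._·_ 𝟚L u top) u
  x·top≈x top = CL.≈-refl 𝟚L
  x·top≈x bot = CL.≡⇒≈ 𝟚L ⊥𝟚L≡bot

module QOProperties {c ℓ ι n} (lem : ExcludedMiddle (c ⊔ ι)) (𝓛 : MultiAdjointFrame c ℓ ι n) where
  open QO lem 𝓛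
  open MultiAdjointFrame 𝓛
  open FrameProperties 𝓛
  open TwoLProperties {c} {ℓ} {ι} lem
  open Scaling using (·-cong; ·-⋁ʳ; ·-⋁ˡ; ⊥𝟚L·x≡⊥; ∧-·)

  -- Among the objects 1, …, n the hom-sets are those of the discrete quantaloid, Q(i,j) being
  -- {⊥ < id} if i = j and {⊥} otherwise; toTwo reads both as the chain, composition becoming meet.
  toTwo : ∀ {a} {A : Set a} (d : Dec A) → ∣ KL (kindD d) ∣ → 𝟚 {c}
  toTwo (yes _) u = u
  toTwo (no _)  _ = bot

  toTwo-injective : ∀ {a} {A : Set a} (d : Dec A) {u v : ∣ KL (kindD d) ∣} →
                    toTwo d u ≡ toTwo d v → Eq (KL (kindD d)) u v
  toTwo-injective (yes _) u≡v = CL.≡⇒≈ 𝟚L u≡v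
  toTwo-injective (no _)  _   = tt

  toTwo-cong : ∀ {a} {A : Set a} (d : Dec A) {u v : ∣ KL (kindD d) ∣} →
               Eq (KL (kindD d)) u v → toTwo d u ≡ toTwo d v
  toTwo-cong (yes _) u≈v = ≈𝟚⇒≡ u≈v
  toTwo-cong (no _)  _   = refl

  toTwo-comp3 : ∀ {i j k : Fin n} (d₁ : Dec (i ≡ j)) (d₂ : Dec (j ≡ k)) (d₃ : Dec (i ≡ k)) v u →
                toTwo d₃ (comp3 d₁ d₂ d₃ v u) ≡ toTwo d₁ u ∧ toTwo d₂ v
  toTwo-comp3 (yes _) (yes _) (yes _) v u = cong (sel u v) ⊥𝟚L≡bot
  toTwo-comp3 (yes i≡j) (yes j≡k) (no i≢k) v u = ⊥₀-elim (i≢k (trans i≡j j≡k))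
  toTwo-comp3 (yes _) (no _) (yes _) v u = trans ⊥𝟚L≡bot (sym (x∧bot≡bot u))
  toTwo-comp3 (yes _) (no _) (no _)  v u = sym (x∧bot≡bot u)
  toTwo-comp3 (no _) _ (yes _) v u = ⊥𝟚L≡bot
  toTwo-comp3 (no _) _ (no _)  v u = refl

  toTwo-compD : ∀ {a} {A : Set a} (d : Dec A) (L : CompleteLattice c ℓ ι) v u →
                compD d v u (Bot L) ≡ Scaling._·_ L (toTwo d v) u
  toTwo-compD (yes _) L v u = refl
  toTwo-compD (no _)  L v u = refl

  toTwo-id≡top : ∀ {a} {A : Set a} (d : Dec A) → A → toTwo d (idD d) ≡ top
  toTwo-id≡top (yes _) _ = refl
  toTwo-id≡top (no ¬a) a = ⊥₀-elim (¬a a)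

  idD-nontrivial : ∀ {a} {A : Set a} (d : Dec A) → A → Lt (KL (kindD d)) (Bot (KL (kindD d))) (idD d)
  idD-nontrivial (yes _) _ = bot<top
  idD-nontrivial (no ¬a) a = ⊥₀-elim (¬a a)

  comp3-cong : ∀ {i j k : Fin n} (d₁ : Dec (i ≡ j)) (d₂ : Dec (j ≡ k)) (d₃ : Dec (i ≡ k)) {v v' u u'} →
               Eq (KL (kindD d₂)) v v' → Eq (KL (kindD d₁)) u u' →
               Eq (KL (kindD d₃)) (comp3 d₁ d₂ d₃ v u) (comp3 d₁ d₂ d₃ v' u')
  comp3-cong d₁ d₂ d₃ {v} {v'} {u} {u'} v≈v' u≈u' = toTwo-injective d₃ (begin
    toTwo d₃ (comp3 d₁ d₂ d₃ v u)   ≡⟨ toTwo-comp3 d₁ d₂ d₃ v u ⟩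
    toTwo d₁ u ∧ toTwo d₂ v         ≡⟨ cong₂ _∧_ (toTwo-cong d₁ u≈u') (toTwo-cong d₂ v≈v') ⟩
    toTwo d₁ u' ∧ toTwo d₂ v'       ≡⟨ toTwo-comp3 d₁ d₂ d₃ v' u' ⟨
    toTwo d₃ (comp3 d₁ d₂ d₃ v' u') ∎)
    where open ≡-Reasoning

  comp3-⋁ˡ : ∀ {i j k : Fin n} (d₁ : Dec (i ≡ j)) (d₂ : Dec (j ≡ k)) (d₃ : Dec (i ≡ k))
             {I : Set ι} (vs : I → ∣ KL (kindD d₂) ∣) u →
             Eq (KL (kindD d₃)) (comp3 d₁ d₂ d₃ (Join (KL (kindD d₂)) vs) u)
                                (Join (KL (kindD d₃)) (λ k → comp3 d₁ d₂ d₃ (vs k) u))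
  comp3-⋁ˡ (yes _) (yes _) (yes _) vs u = ·-⋁ʳ 𝟚L u vs
  comp3-⋁ˡ (yes _) (no _)  (yes _) vs u = CL.⊥L≈⋁⊥L 𝟚L
  comp3-⋁ˡ (no _)  _       (yes _) vs u = CL.⊥L≈⋁⊥L 𝟚L
  comp3-⋁ˡ _       _       (no _)  vs u = tt

  comp3-⋁ʳ : ∀ {i j k : Fin n} (d₁ : Dec (i ≡ j)) (d₂ : Dec (j ≡ k)) (d₃ : Dec (i ≡ k))
             {I : Set ι} v (us : I → ∣ KL (kindD d₁) ∣) →
             Eq (KL (kindD d₃)) (comp3 d₁ d₂ d₃ v (Join (KL (kindD d₁)) us))
                                (Join (KL (kindD d₃)) (λ k → comp3 d₁ d₂ d₃ v (us k)))
  comp3-⋁ʳ (yes _) (yes _) (yes _) v us = ·-⋁ˡ 𝟚L us v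
  comp3-⋁ʳ (yes _) (no _)  (yes _) v us = CL.⊥L≈⋁⊥L 𝟚L
  comp3-⋁ʳ (no _)  _       (yes _) v us = CL.⊥L≈⋁⊥L 𝟚L
  comp3-⋁ʳ _       _       (no _)  v us = tt

  comp3-identityˡ : ∀ {i j : Fin n} (d₁ : Dec (i ≡ j)) (d₂ : Dec (j ≡ j)) u →
                    Eq (KL (kindD d₁)) (comp3 d₁ d₂ d₁ (idD d₂) u) u
  comp3-identityˡ d₁ d₂ u = toTwo-injective d₁ (begin
    toTwo d₁ (comp3 d₁ d₂ d₁ (idD d₂) u) ≡⟨ toTwo-comp3 d₁ d₂ d₁ (idD d₂) u ⟩
    toTwo d₁ u ∧ toTwo d₂ (idD d₂)       ≡⟨ cong (toTwo d₁ u ∧_) (toTwo-id≡top d₂ refl) ⟩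
    toTwo d₁ u ∧ top                     ≡⟨ x∧top≡x (toTwo d₁ u) ⟩
    toTwo d₁ u                           ∎)
    where open ≡-Reasoning

  comp3-identityʳ : ∀ {i j : Fin n} (d₁ : Dec (i ≡ i)) (d₂ : Dec (i ≡ j)) v →
                    Eq (KL (kindD d₂)) (comp3 d₁ d₂ d₂ v (idD d₁)) v
  comp3-identityʳ d₁ d₂ v = toTwo-injective d₂ (begin
    toTwo d₂ (comp3 d₁ d₂ d₂ v (idD d₁)) ≡⟨ toTwo-comp3 d₁ d₂ d₂ v (idD d₁) ⟩
    toTwo d₁ (idD d₁) ∧ toTwo d₂ v       ≡⟨ cong (_∧ toTwo d₂ v) (toTwo-id≡top d₁ refl) ⟩
    toTwo d₂ v                           ∎)
    where open ≡-Reasoning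

  comp3-assoc : ∀ {i j k l : Fin n} (dij : Dec (i ≡ j)) (djk : Dec (j ≡ k)) (dik : Dec (i ≡ k))
                (dkl : Dec (k ≡ l)) (djl : Dec (j ≡ l)) (dil : Dec (i ≡ l)) h g f →
                Eq (KL (kindD dil)) (comp3 dij djl dil (comp3 djk dkl djl h g) f)
                                    (comp3 dik dkl dil h (comp3 dij djk dik g f))
  comp3-assoc dij djk dik dkl djl dil h g f = toTwo-injective dil (begin
    toTwo dil (comp3 dij djl dil (comp3 djk dkl djl h g) f)
      ≡⟨ toTwo-comp3 dij djl dil _ f ⟩
    toTwo dij f ∧ toTwo djl (comp3 djk dkl djl h g)
      ≡⟨ cong (toTwo dij f ∧_) (toTwo-comp3 djk dkl djl h g) ⟩
    toTwo dij f ∧ (toTwo djk g ∧ toTwo dkl h)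
      ≡⟨ ∧-assoc (toTwo dij f) (toTwo djk g) (toTwo dkl h) ⟨
    (toTwo dij f ∧ toTwo djk g) ∧ toTwo dkl h
      ≡⟨ cong (_∧ toTwo dkl h) (toTwo-comp3 dij djk dik g f) ⟨
    toTwo dik (comp3 dij djk dik g f) ∧ toTwo dkl h
      ≡⟨ toTwo-comp3 dik dkl dil h _ ⟨
    toTwo dil (comp3 dik dkl dil h (comp3 dij djk dik g f)) ∎)
    where open ≡-Reasoning

  module _ (L : CompleteLattice c ℓ ι) where
    private
      module L = CompleteLatticeProperties L
    open Scaling L using (_·_)

    compD-cong : ∀ {a} {A : Set a} (d : Dec A) {v v' u u'} →
                 Eq (KL (kindD d)) v v' → Eq L u u' → Eq L (compD d v u (Bot L)) (compD d v' u' (Bot L))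
    compD-cong (yes _) v≈v' u≈u' = ·-cong L v≈v' u≈u'
    compD-cong (no _)  v≈v' u≈u' = L.≈-refl

    compD-⋁ˡ : ∀ {a} {A : Set a} (d : Dec A) {I : Set ι} (vs : I → ∣ KL (kindD d) ∣) u →
               Eq L (compD d (Join (KL (kindD d)) vs) u (Bot L)) (Join L (λ k → compD d (vs k) u (Bot L)))
    compD-⋁ˡ (yes _) vs u = ·-⋁ˡ L vs u
    compD-⋁ˡ (no _)  vs u = L.⊥L≈⋁⊥L

    compD-⋁ʳ : ∀ {a} {A : Set a} (d : Dec A) {I : Set ι} v (us : I → ∣ L ∣) →
               Eq L (compD d v (Join L us) (Bot L)) (Join L (λ k → compD d v (us k) (Bot L)))
    compD-⋁ʳ (yes _) v us = ·-⋁ʳ L v us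
    compD-⋁ʳ (no _)  v us = L.⊥L≈⋁⊥L

    compD-identity : ∀ {a} {A : Set a} (d : Dec A) → A → ∀ u → compD d (idD d) u (Bot L) ≡ u
    compD-identity (yes _) _ u = refl
    compD-identity (no ¬a) a u = ⊥₀-elim (¬a a)

    compD-assoc : ∀ {j k l : Fin n} (djk : Dec (j ≡ k)) (dkl : Dec (k ≡ l)) (djl : Dec (j ≡ l)) h g f →
                  Eq L (compD djl (comp3 djk dkl djl h g) f (Bot L)) (compD dkl h (compD djk g f (Bot L)) (Bot L))
    compD-assoc djk dkl djl h g f = L.≡⇒≈ (begin
      compD djl (comp3 djk dkl djl h g) f (Bot L)   ≡⟨ toTwo-compD djl L _ f ⟩
      toTwo djl (comp3 djk dkl djl h g) · f         ≡⟨ cong (_· f) (toTwo-comp3 djk dkl djl h g) ⟩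
      (toTwo djk g ∧ toTwo dkl h) · f               ≡⟨ ∧-· L (toTwo djk g) (toTwo dkl h) f ⟩
      toTwo dkl h · (toTwo djk g · f)               ≡⟨ cong (toTwo dkl h ·_) (toTwo-compD djk L g f) ⟨
      toTwo dkl h · compD djk g f (Bot L)           ≡⟨ toTwo-compD dkl L h _ ⟨
      compD dkl h (compD djk g f (Bot L)) (Bot L)   ∎)
      where open ≡-Reasoning

  &-· : ∀ i x u z → Eq L₂ (x &[ i ] Scaling._·_ P u z) (Scaling._·_ L₂ u (x &[ i ] z))
  &-· i x top z = CL.≈-refl L₂
  &-· i x bot z = &ʳ.⊥-preserving i x

  &-compD : ∀ {k l : Fin n} (d : Dec (k ≡ l)) h g f →
            Eq L₂ (f &[ l ] compD d h g (Bot P)) (compD d h (f &[ k ] g) (Bot L₂))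
  &-compD (yes refl) h g f = &-· _ f h g
  &-compD (no _)     h g f = &ʳ.⊥-preserving _ f

  comp-cong : ∀ x y z {v v' : H y z} {u u' : H x y} → Eq (Hom y z) v v' → Eq (Hom x y) u u' →
              Eq (Hom x z) (comp x y z v u) (comp x y z v' u')
  comp-cong obj₋₁   obj₋₁   z       v≈v' u≈u' = ·-cong (Hom obj₋₁ z) u≈u' v≈v'
  comp-cong obj₋₁   obj₀    obj₋₁   _    _    = CL.≈-refl 𝟚L
  comp-cong obj₋₁   obj₀    obj₀    v≈v' u≈u' = ·-cong L₁ v≈v' u≈u'
  comp-cong obj₋₁   obj₀    (obj i) v≈v' u≈u' = &-cong i u≈u' v≈v'
  comp-cong obj₋₁   (obj j) obj₋₁   _    _    = CL.≈-refl 𝟚L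
  comp-cong obj₋₁   (obj j) obj₀    _    _    = CL.≈-refl L₁
  comp-cong obj₋₁   (obj j) (obj k) v≈v' u≈u' = compD-cong L₂ (j ≟ k) v≈v' u≈u'
  comp-cong obj₀    obj₋₁   z       _    _    = CL.≈-refl (Hom obj₀ z)
  comp-cong obj₀    obj₀    z       v≈v' u≈u' = ·-cong (Hom obj₀ z) u≈u' v≈v'
  comp-cong obj₀    (obj j) obj₋₁   _    _    = tt
  comp-cong obj₀    (obj j) obj₀    _    _    = CL.≈-refl 𝟚L
  comp-cong obj₀    (obj j) (obj k) v≈v' u≈u' = compD-cong P (j ≟ k) v≈v' u≈u'
  comp-cong (obj i) obj₋₁   z       _    _    = CL.≈-refl (Hom (obj i) z)
  comp-cong (obj i) obj₀    z       _    _    = CL.≈-refl (Hom (obj i) z)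
  comp-cong (obj i) (obj j) obj₋₁   _    _    = tt
  comp-cong (obj i) (obj j) obj₀    _    _    = tt
  comp-cong (obj i) (obj j) (obj k) v≈v' u≈u' = comp3-cong (i ≟ j) (j ≟ k) (i ≟ k) v≈v' u≈u'

  comp-⋁ˡ : ∀ x y z {I : Set ι} (vs : I → H y z) (u : H x y) →
            Eq (Hom x z) (comp x y z (Join (Hom y z) vs) u) (Join (Hom x z) (λ k → comp x y z (vs k) u))
  comp-⋁ˡ obj₋₁   obj₋₁   z       vs u = ·-⋁ʳ (Hom obj₋₁ z) u vs
  comp-⋁ˡ obj₋₁   obj₀    obj₋₁   vs u = CL.⊥L≈⋁⊥L 𝟚L
  comp-⋁ˡ obj₋₁   obj₀    obj₀    vs u = ·-⋁ˡ L₁ vs u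
  comp-⋁ˡ obj₋₁   obj₀    (obj i) vs u = &ʳ.⋁-preserving i u vs
  comp-⋁ˡ obj₋₁   (obj j) obj₋₁   vs u = CL.⊥L≈⋁⊥L 𝟚L
  comp-⋁ˡ obj₋₁   (obj j) obj₀    vs u = CL.⊥L≈⋁⊥L L₁
  comp-⋁ˡ obj₋₁   (obj j) (obj k) vs u = compD-⋁ˡ L₂ (j ≟ k) vs u
  comp-⋁ˡ obj₀    obj₋₁   z       vs u = CL.⊥L≈⋁⊥L (Hom obj₀ z)
  comp-⋁ˡ obj₀    obj₀    z       vs u = ·-⋁ʳ (Hom obj₀ z) u vs
  comp-⋁ˡ obj₀    (obj j) obj₋₁   vs u = tt
  comp-⋁ˡ obj₀    (obj j) obj₀    vs u = CL.⊥L≈⋁⊥L 𝟚L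
  comp-⋁ˡ obj₀    (obj j) (obj k) vs u = compD-⋁ˡ P (j ≟ k) vs u
  comp-⋁ˡ (obj i) obj₋₁   z       vs u = CL.⊥L≈⋁⊥L (Hom (obj i) z)
  comp-⋁ˡ (obj i) obj₀    z       vs u = CL.⊥L≈⋁⊥L (Hom (obj i) z)
  comp-⋁ˡ (obj i) (obj j) obj₋₁   vs u = tt
  comp-⋁ˡ (obj i) (obj j) obj₀    vs u = tt
  comp-⋁ˡ (obj i) (obj j) (obj k) vs u = comp3-⋁ˡ (i ≟ j) (j ≟ k) (i ≟ k) vs u

  comp-⋁ʳ : ∀ x y z {I : Set ι} (v : H y z) (us : I → H x y) →
            Eq (Hom x z) (comp x y z v (Join (Hom x y) us)) (Join (Hom x z) (λ k → comp x y z v (us k)))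
  comp-⋁ʳ obj₋₁   obj₋₁   z       v us = ·-⋁ˡ (Hom obj₋₁ z) us v
  comp-⋁ʳ obj₋₁   obj₀    obj₋₁   v us = CL.⊥L≈⋁⊥L 𝟚L
  comp-⋁ʳ obj₋₁   obj₀    obj₀    v us = ·-⋁ʳ L₁ v us
  comp-⋁ʳ obj₋₁   obj₀    (obj i) v us = &ˡ.⋁-preserving i v us
  comp-⋁ʳ obj₋₁   (obj j) obj₋₁   v us = CL.⊥L≈⋁⊥L 𝟚L
  comp-⋁ʳ obj₋₁   (obj j) obj₀    v us = CL.⊥L≈⋁⊥L L₁
  comp-⋁ʳ obj₋₁   (obj j) (obj k) v us = compD-⋁ʳ L₂ (j ≟ k) v us
  comp-⋁ʳ obj₀    obj₋₁   z       v us = CL.⊥L≈⋁⊥L (Hom obj₀ z)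
  comp-⋁ʳ obj₀    obj₀    z       v us = ·-⋁ˡ (Hom obj₀ z) us v
  comp-⋁ʳ obj₀    (obj j) obj₋₁   v us = tt
  comp-⋁ʳ obj₀    (obj j) obj₀    v us = CL.⊥L≈⋁⊥L 𝟚L
  comp-⋁ʳ obj₀    (obj j) (obj k) v us = compD-⋁ʳ P (j ≟ k) v us
  comp-⋁ʳ (obj i) obj₋₁   z       v us = CL.⊥L≈⋁⊥L (Hom (obj i) z)
  comp-⋁ʳ (obj i) obj₀    z       v us = CL.⊥L≈⋁⊥L (Hom (obj i) z)
  comp-⋁ʳ (obj i) (obj j) obj₋₁   v us = tt
  comp-⋁ʳ (obj i) (obj j) obj₀    v us = tt
  comp-⋁ʳ (obj i) (obj j) (obj k) v us = comp3-⋁ʳ (i ≟ j) (j ≟ k) (i ≟ k) v us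

  comp-⊥ˡ : ∀ x y z (u : H x y) → Eq (Hom x z) (comp x y z (⊥H y z) u) (⊥H x z)
  comp-⊥ˡ x y z u = CL.≈-trans (Hom x z) (comp-⋁ˡ x y z _ u) (CL.⋁-⊥ (Hom x z) _ (λ ()))

  comp-⊥ʳ : ∀ x y z (v : H y z) → Eq (Hom x z) (comp x y z v (⊥H x y)) (⊥H x z)
  comp-⊥ʳ x y z v = CL.≈-trans (Hom x z) (comp-⋁ʳ x y z v _) (CL.⋁-⊥ (Hom x z) _ (λ ()))

  identityˡ : ∀ x y (f : H x y) → Eq (Hom x y) (comp x y y (idQ y) f) f
  identityˡ obj₋₁   obj₋₁   f = x·top≈x f
  identityˡ obj₋₁   obj₀    f = CL.≈-refl L₁
  identityˡ obj₋₁   (obj j) f = CL.≡⇒≈ L₂ (compD-identity L₂ (j ≟ j) refl f)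
  identityˡ obj₀    obj₋₁   f = tt
  identityˡ obj₀    obj₀    f = x·top≈x f
  identityˡ obj₀    (obj j) f = CL.≡⇒≈ P (compD-identity P (j ≟ j) refl f)
  identityˡ (obj i) obj₋₁   f = tt
  identityˡ (obj i) obj₀    f = tt
  identityˡ (obj i) (obj j) f = comp3-identityˡ (i ≟ j) (j ≟ j) f

  identityʳ : ∀ x y (f : H x y) → Eq (Hom x y) (comp x x y f (idQ x)) f
  identityʳ obj₋₁   y       f = CL.≈-refl (Hom obj₋₁ y)
  identityʳ obj₀    y       f = CL.≈-refl (Hom obj₀ y)
  identityʳ (obj i) obj₋₁   f = tt
  identityʳ (obj i) obj₀    f = tt
  identityʳ (obj i) (obj j) f = comp3-identityʳ (i ≟ i) (i ≟ j) f

  assoc : ∀ w x y z (h : H y z) (g : H x y) (f : H w x) →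
          Eq (Hom w z) (comp w x z (comp x y z h g) f) (comp w y z h (comp w x y g f))
  assoc obj₋₁ obj₋₁ y z h g top = CL.≈-refl (Hom obj₋₁ z)
  assoc obj₋₁ obj₋₁ y z h g bot = CL.≈-sym (Hom obj₋₁ z) (comp-⊥ʳ obj₋₁ y z h)
  assoc obj₋₁ obj₀ obj₋₁ z h g f =
    CL.both-≈⊥L (Hom obj₋₁ z) (comp-⊥ˡ obj₋₁ obj₀ z f) (CL.≡⇒≈ (Hom obj₋₁ z) (⊥𝟚L·x≡⊥ (Hom obj₋₁ z) h))
  assoc obj₋₁ obj₀ obj₀ z h top f = CL.≈-refl (Hom obj₋₁ z)
  assoc obj₋₁ obj₀ obj₀ z h bot f =
    CL.both-≈⊥L (Hom obj₋₁ z) (comp-⊥ˡ obj₋₁ obj₀ z f) (comp-⊥ʳ obj₋₁ obj₀ z h)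
  assoc obj₋₁ obj₀ (obj k) obj₋₁ h g f = CL.≈-refl 𝟚L
  assoc obj₋₁ obj₀ (obj k) obj₀ h g f = CL.≡⇒≈ L₁ (⊥𝟚L·x≡⊥ L₁ f)
  assoc obj₋₁ obj₀ (obj k) (obj l) h g f = &-compD (k ≟ l) h g f
  assoc obj₋₁ (obj j) obj₋₁ z h g f =
    CL.both-≈⊥L (Hom obj₋₁ z) (comp-⊥ˡ obj₋₁ (obj j) z f) (CL.≡⇒≈ (Hom obj₋₁ z) (⊥𝟚L·x≡⊥ (Hom obj₋₁ z) h))
  assoc obj₋₁ (obj j) obj₀ z h g f =
    CL.both-≈⊥L (Hom obj₋₁ z) (comp-⊥ˡ obj₋₁ (obj j) z f) (comp-⊥ʳ obj₋₁ obj₀ z h)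
  assoc obj₋₁ (obj j) (obj k) obj₋₁ h g f = CL.≈-refl 𝟚L
  assoc obj₋₁ (obj j) (obj k) obj₀ h g f = CL.≈-refl L₁
  assoc obj₋₁ (obj j) (obj k) (obj l) h g f = compD-assoc L₂ (j ≟ k) (k ≟ l) (j ≟ l) h g f
  assoc obj₀ obj₋₁ y z h g f = CL.≈-sym (Hom obj₀ z) (comp-⊥ʳ obj₀ y z h)
  assoc obj₀ obj₀ y z h g top = CL.≈-refl (Hom obj₀ z)
  assoc obj₀ obj₀ y z h g bot = CL.≈-sym (Hom obj₀ z) (comp-⊥ʳ obj₀ y z h)
  assoc obj₀ (obj j) obj₋₁ z h g f = comp-⊥ˡ obj₀ (obj j) z f
  assoc obj₀ (obj j) obj₀ z h g f =
    CL.both-≈⊥L (Hom obj₀ z) (comp-⊥ˡ obj₀ (obj j) z f) (CL.≡⇒≈ (Hom obj₀ z) (⊥𝟚L·x≡⊥ (Hom obj₀ z) h))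
  assoc obj₀ (obj j) (obj k) obj₋₁ h g f = tt
  assoc obj₀ (obj j) (obj k) obj₀ h g f = CL.≈-refl 𝟚L
  assoc obj₀ (obj j) (obj k) (obj l) h g f = compD-assoc P (j ≟ k) (k ≟ l) (j ≟ l) h g f
  assoc (obj i) obj₋₁ y z h g f = CL.≈-sym (Hom (obj i) z) (comp-⊥ʳ (obj i) y z h)
  assoc (obj i) obj₀ y z h g f = CL.≈-sym (Hom (obj i) z) (comp-⊥ʳ (obj i) y z h)
  assoc (obj i) (obj j) obj₋₁ z h g f = comp-⊥ˡ (obj i) (obj j) z f
  assoc (obj i) (obj j) obj₀ z h g f = comp-⊥ˡ (obj i) (obj j) z f
  assoc (obj i) (obj j) (obj k) obj₋₁ h g f = tt
  assoc (obj i) (obj j) (obj k) obj₀ h g f = tt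
  assoc (obj i) (obj j) (obj k) (obj l) h g f =
    comp3-assoc (i ≟ j) (j ≟ k) (i ≟ k) (k ≟ l) (j ≟ l) (i ≟ l) h g f

  isQuantaloid : IsQuantaloid Hom comp idQ
  isQuantaloid = record
    { comp-cong = comp-cong
    ; assoc     = assoc
    ; identityˡ = identityˡ
    ; identityʳ = identityʳ
    ; comp-⋁ˡ   = comp-⋁ˡ
    ; comp-⋁ʳ   = comp-⋁ʳ
    }

  isNonTrivial : IsNonTrivial Hom idQ
  isNonTrivial obj₋₁   = bot<top
  isNonTrivial obj₀    = bot<top
  isNonTrivial (obj i) = idD-nontrivial (i ≟ i) refl

proposition5p5 : ∀ {c ℓ ι n} (lem : ExcludedMiddle (c ⊔ ι)) (𝓛 : MultiAdjointFrame c ℓ ι n) →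
    IsQuantaloid (QO.Hom lem 𝓛) (QO.comp lem 𝓛) (QO.idQ lem 𝓛)
    × IsNonTrivial (QO.Hom lem 𝓛) (QO.idQ lem 𝓛)
    × (∀ i (u : ∣ MultiAdjointFrame.L₁ 𝓛 ∣) (w : ∣ MultiAdjointFrame.L₂ 𝓛 ∣) →
         IsLeftImp (QO.Hom lem 𝓛) (QO.comp lem 𝓛) obj₋₁ obj₀ (obj i) u w
           (MultiAdjointFrame._↖[_]_ 𝓛 w i u))
    × (∀ i (v : ∣ MultiAdjointFrame.P 𝓛 ∣) (w : ∣ MultiAdjointFrame.L₂ 𝓛 ∣) →
         IsRightImp (QO.Hom lem 𝓛) (QO.comp lem 𝓛) obj₋₁ obj₀ (obj i) v w
           (MultiAdjointFrame._↙[_]_ 𝓛 w i v))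
proposition5p5 lem 𝓛 =
    QOProperties.isQuantaloid lem 𝓛
  , QOProperties.isNonTrivial lem 𝓛
  , (λ i u w v → FrameProperties.&⊣↖ 𝓛 i u v w)
  , (λ i v w u → MultiAdjointFrame.adj₁ 𝓛 i u v w)
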